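{- Let $K_4-e$ denote the graph obtained from the complete graph $K_4$ by deleting a single edge. Then $K_4-e$ is not in $\mathcal{U}$.
   Context: A clause is a disjunction of literals (Boolean variables or their negations); a reduced 2-CNF is a conjunction of clauses each consisting of exactly two literals on two distinct variables, with no repeated clause. With $|x|=|\neg x|=x$, the associated multigraph of such a CNF has as vertices the variables occurring in it and one edge $\{|a|,|b|\}$ per clause $(a\vee b)$; the CNF is simple if it has no multiple edges, in which case the graph is denoted $\mathcal{G}(S)$. $\mathcal{U}$ is the family of graphs $\mathcal{G}(S)$ with $S$ an unsatisfiable simple 2-CNF. -}

module Defs where

open import Data.Nat using (ℕ)
open import Data.Bool using (Bool; true; false; not; _∨_; T)
open import Data.Fin using (Fin)
open import Data.List using (List; length; lookup)
open import Data.List.Relation.Unary.All using (All)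
open import Data.List.Relation.Unary.Any using (Any)
open import Data.Product using (Σ; ∃; _×_; _,_)
open import Data.Sum using (_⊎_)
open import Relation.Nullary using (¬_)
open import Relation.Binary.PropositionalEquality using (_≡_; _≢_)
open import Function.Bundles using (_⇔_)

data Literal : Set where
  pos : ℕ → Literal
  neg : ℕ → Literal

∣_∣ : Literal → ℕ
∣ pos x ∣ = x
∣ neg x ∣ = x

record Clause : Set where
  constructor _∨ₗ_
  field
    fst : Literal
    snd : Literal
open Clause public

CNF : Set
CNF = List Clause

evalLit : (ℕ → Bool) → Literal → Bool
evalLit ρ (pos x) = ρ x
evalLit ρ (neg x) = not (ρ x)

evalClause : (ℕ → Bool) → Clause → Bool
evalClause ρ c = evalLit ρ (fst c) ∨ evalLit ρ (snd c)

Satisfiable : CNF → Set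
Satisfiable S = Σ (ℕ → Bool) λ ρ → All (λ c → T (evalClause ρ c)) S

Unsatisfiable : CNF → Set
Unsatisfiable S = ¬ Satisfiable S

SameClause : Clause → Clause → Set
SameClause c d = (fst c ≡ fst d × snd c ≡ snd d) ⊎ (fst c ≡ snd d × snd c ≡ fst d)

SameVarPair : Clause → Clause → Set
SameVarPair c d = (∣ fst c ∣ ≡ ∣ fst d ∣ × ∣ snd c ∣ ≡ ∣ snd d ∣)
                ⊎ (∣ fst c ∣ ≡ ∣ snd d ∣ × ∣ snd c ∣ ≡ ∣ fst d ∣)

Reduced : CNF → Set
Reduced S = All (λ c → ∣ fst c ∣ ≢ ∣ snd c ∣) S
          × ((i j : Fin (length S)) → SameClause (lookup S i) (lookup S j) → i ≡ j)

-- simple: the associated multigraph has no multiple edges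
Simple : CNF → Set
Simple S = (i j : Fin (length S)) → SameVarPair (lookup S i) (lookup S j) → i ≡ j

-- the graph 𝒢(S): vertices = variables occurring in S, one edge {|a|,|b|} per clause
Occurs : ℕ → CNF → Set
Occurs x S = Any (λ c → ∣ fst c ∣ ≡ x ⊎ ∣ snd c ∣ ≡ x) S

Adj𝒢 : CNF → ℕ → ℕ → Set
Adj𝒢 S x y = Any (λ c → (∣ fst c ∣ ≡ x × ∣ snd c ∣ ≡ y) ⊎ (∣ fst c ∣ ≡ y × ∣ snd c ∣ ≡ x)) S

_≅𝒢_ : CNF → {n : ℕ} → (Fin n → Fin n → Set) → Set
_≅𝒢_ S {n} A = Σ (Fin n → ℕ) λ f →
    ((i j : Fin n) → f i ≡ f j → i ≡ j)
  × ((i : Fin n) → Occurs (f i) S)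
  × ((x : ℕ) → Occurs x S → ∃ λ i → f i ≡ x)
  × ((i j : Fin n) → A i j ⇔ Adj𝒢 S (f i) (f j))

In𝒰 : (n : ℕ) → (Fin n → Fin n → Set) → Set
In𝒰 n A = Σ CNF λ S → Reduced S × Simple S × Unsatisfiable S × (S ≅𝒢 A)

-- K₄ - e on vertices 0,1,2,3 with the edge {2,3} deleted
K4-e : Fin 4 → Fin 4 → Set
K4-e i j = i ≢ j × ¬ (i ≡ Fin.suc (Fin.suc Fin.zero) × j ≡ Fin.suc (Fin.suc (Fin.suc Fin.zero)))
                 × ¬ (j ≡ Fin.suc (Fin.suc Fin.zero) × i ≡ Fin.suc (Fin.suc (Fin.suc Fin.zero)))

-- In a simple 2-CNF every edge of the graph carries exactly one clause, so the CNF is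
-- just a choice of literal signs at both ends of every edge ("a signing" of the graph).
-- Hence a graph lies outside 𝒰 as soon as every signing is satisfiable, and for K₄ - e
-- this is a finite check: the edge {0,1} and each of the degree-two vertices 2 and 3
-- forbid at most one value of (x₀, x₁) each, so one of the four values survives.
module Submission where

open import Defs
open import Relation.Nullary using (¬_)

open import Level using (0ℓ)
open import Data.Nat using (ℕ; _≟_)
open import Data.Bool using (Bool; true; false; not; _∨_; T)
open import Data.Bool.Properties using (∨-comm)
open import Data.Empty using (⊥-elim)
open import Data.Fin using (Fin; zero; suc)
open import Data.Fin.Properties using (any?; all?)
open import Data.Vec using (Vec; []; _∷_; lookup; tabulate)
open import Data.Vec.Properties using (lookup∘tabulate)
import Data.List as List
open import Data.List.Membership.Propositional using (_∈_)
open import Data.List.Relation.Unary.All as All using (All)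
open import Data.List.Relation.Unary.Any as Any using (Any)
open import Data.List.Relation.Unary.Any.Properties using (lookup-index)
open import Data.Product using (∃; ∃-syntax; _×_; _,_; proj₁; map₂)
open import Data.Sum using (_⊎_; inj₁; inj₂)
open import Function using (_∘_)
open import Function.Bundles using (_⇔_; Equivalence)
open import Relation.Binary.PropositionalEquality
  using (_≡_; refl; sym; trans; cong; cong₂; subst; _≗_; module ≡-Reasoning)
open import Relation.Nullary.Decidable using (Dec; yes; no; map′; ¬?; _⊎-dec_; T?; decidable-stable; from-yes)
open import Relation.Unary using (Pred; Decidable)

Searchable : Set → Set₁
Searchable A = {P : Pred A 0ℓ} → Decidable P → Dec (∃ P)

Bool-searchable : Searchable Bool
Bool-searchable P? = map′ fromSum toSum (P? true ⊎-dec P? false)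
  where
  fromSum : _ → _
  fromSum (inj₁ p) = true , p
  fromSum (inj₂ p) = false , p
  toSum : _ → _
  toSum (true , p) = inj₁ p
  toSum (false , p) = inj₂ p

×-searchable : ∀ {A B} → Searchable A → Searchable B → Searchable (A × B)
×-searchable A? B? P? =
  map′ (λ (a , b , p) → (a , b) , p) (λ ((a , b) , p) → a , b , p)
       (A? λ a → B? λ b → P? (a , b))

Vec-searchable : ∀ {A} → Searchable A → ∀ n → Searchable (Vec A n)
Vec-searchable A? ℕ.zero P? = map′ ([] ,_) (λ { ([] , p) → p }) (P? [])
Vec-searchable A? (ℕ.suc n) P? =
  map′ (λ (a , v , p) → a ∷ v , p) (λ { (a ∷ v , p) → a , v , p })
       (A? λ a → Vec-searchable A? n λ v → P? (a ∷ v))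

∀-dec : ∀ {A} {P : Pred A 0ℓ} → Searchable A → Decidable P → Dec (∀ x → P x)
∀-dec A? P? =
  map′ (λ ∄¬P x → decidable-stable (P? x) (∄¬P ∘ (x ,_)))
       (λ ∀P (x , ¬Px) → ¬Px (∀P x))
       (¬? (A? (¬? ∘ P?)))

signed : Bool → Bool → Bool
signed true  x = x
signed false x = not x

signedClause : Bool × Bool → Bool → Bool → Bool
signedClause (s , t) x y = signed s x ∨ signed t y

sign : Literal → Bool
sign (pos _) = true
sign (neg _) = false

evalLit-signed : ∀ ρ l → evalLit ρ l ≡ signed (sign l) (ρ ∣ l ∣)
evalLit-signed ρ (pos x) = refl
evalLit-signed ρ (neg x) = refl

-- The predicate under Any in Adj𝒢, so lookup-index of an adjacency proof has this type.
Joins : Clause → ℕ → ℕ → Set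
Joins c u v = (∣ fst c ∣ ≡ u × ∣ snd c ∣ ≡ v) ⊎ (∣ fst c ∣ ≡ v × ∣ snd c ∣ ≡ u)

signsAlong : ∀ c {u v} → Joins c u v → Bool × Bool
signsAlong c (inj₁ _) = sign (fst c) , sign (snd c)
signsAlong c (inj₂ _) = sign (snd c) , sign (fst c)

evalClause-signsAlong : ∀ ρ c {u v} (j : Joins c u v) →
  evalClause ρ c ≡ signedClause (signsAlong c j) (ρ u) (ρ v)
evalClause-signsAlong ρ c (inj₁ (refl , refl)) =
  cong₂ _∨_ (evalLit-signed ρ (fst c)) (evalLit-signed ρ (snd c))
evalClause-signsAlong ρ c {u} {v} (inj₂ (refl , refl)) =
  trans (cong₂ _∨_ (evalLit-signed ρ (fst c)) (evalLit-signed ρ (snd c)))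
        (∨-comm (signed (sign (fst c)) (ρ v)) (signed (sign (snd c)) (ρ u)))

joins-sameVarPair : ∀ {c d u v} → Joins c u v → Joins d u v → SameVarPair c d
joins-sameVarPair (inj₁ (refl , refl)) (inj₁ (p , q)) = inj₁ (sym p , sym q)
joins-sameVarPair (inj₁ (refl , refl)) (inj₂ (p , q)) = inj₂ (sym q , sym p)
joins-sameVarPair (inj₂ (refl , refl)) (inj₁ (p , q)) = inj₂ (sym q , sym p)
joins-sameVarPair (inj₂ (refl , refl)) (inj₂ (p , q)) = inj₁ (sym p , sym q)

simple-∈-unique : ∀ {S x} → Simple S → (x∈S : x ∈ S) (k : Fin (List.length S)) →
  SameVarPair x (List.lookup S k) → x ≡ List.lookup S k
simple-∈-unique {S} simple x∈S k same =
  trans (lookup-index x∈S)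
        (cong (List.lookup S)
              (simple (Any.index x∈S) k
                      (subst (λ c → SameVarPair c (List.lookup S k)) (lookup-index x∈S) same)))

extendAlong : ∀ {n} → (Fin n → ℕ) → (Fin n → Bool) → ℕ → Bool
extendAlong f b x with any? (λ i → f i ≟ x)
... | yes (i , _) = b i
... | no _        = false

extendAlong-correct : ∀ {n} (f : Fin n → ℕ) (b : Fin n → Bool) →
  ((i j : Fin n) → f i ≡ f j → i ≡ j) → ∀ k → extendAlong f b (f k) ≡ b k
extendAlong-correct f b f-inj k with any? (λ i → f i ≟ f k)
... | yes (i , fi≡fk) = cong b (f-inj i k fi≡fk)
... | no ∄i           = ⊥-elim (∄i (k , refl))

record EdgeEnumeration {n} (A : Fin n → Fin n → Set) (m : ℕ) : Set where
  field
    src tgt : Fin m → Fin n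
    edge    : ∀ e → A (src e) (tgt e)
    covers  : ∀ i j → A i j → ∃[ e ] ((i ≡ src e × j ≡ tgt e) ⊎ (i ≡ tgt e × j ≡ src e))

module _ {n m} {A : Fin n → Fin n → Set} (E : EdgeEnumeration A m) where
  open EdgeEnumeration E

  SignedSatisfiable : (Fin m → Bool × Bool) → Set
  SignedSatisfiable σ = ∃[ b ] ∀ e → T (signedClause (σ e) (lookup b (src e)) (lookup b (tgt e)))

  signedSatisfiable-resp-≗ : ∀ {σ τ} → σ ≗ τ → SignedSatisfiable σ → SignedSatisfiable τ
  signedSatisfiable-resp-≗ σ≗τ =
    map₂ λ sat e → subst (λ s → T (signedClause s _ _)) (σ≗τ e) (sat e)

  everySigningSatisfiable? : Dec (∀ σ → SignedSatisfiable σ)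
  everySigningSatisfiable? =
    map′ (λ ∀σ σ → signedSatisfiable-resp-≗ (lookup∘tabulate σ) (∀σ (tabulate σ)))
         (λ ∀σ σ → ∀σ (lookup σ))
         (∀-dec (Vec-searchable (×-searchable Bool-searchable Bool-searchable) m)
                λ σ → Vec-searchable Bool-searchable n λ b → all? λ e → T? _)

  module _ {S : CNF} (f : Fin n → ℕ) (iso : ∀ i j → A i j ⇔ Adj𝒢 S (f i) (f j)) where
    open ≡-Reasoning

    edgeAdjacency : ∀ e → Adj𝒢 S (f (src e)) (f (tgt e))
    edgeAdjacency e = Equivalence.to (iso (src e) (tgt e)) (edge e)

    edgeClause : Fin m → Clause
    edgeClause e = List.lookup S (Any.index (edgeAdjacency e))

    edgeClause-joins : ∀ e → Joins (edgeClause e) (f (src e)) (f (tgt e))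
    edgeClause-joins e = lookup-index (edgeAdjacency e)

    edgeSigning : Fin m → Bool × Bool
    edgeSigning e = signsAlong (edgeClause e) (edgeClause-joins e)

    ∈-edgeClause : Simple S → (∀ x → Occurs x S → ∃ λ i → f i ≡ x) →
      ∀ {c} → c ∈ S → ∃[ e ] c ≡ edgeClause e
    ∈-edgeClause simple onto {c} c∈S
      with onto _ (Any.map (λ { refl → inj₁ refl }) c∈S) | onto _ (Any.map (λ { refl → inj₂ refl }) c∈S)
    ... | i , fi≡ | j , fj≡
      with covers i j (Equivalence.from (iso i j) (Any.map (λ { refl → inj₁ (sym fi≡ , sym fj≡) }) c∈S))
    ... | e , orientation =
      e , simple-∈-unique simple c∈S _
            (joins-sameVarPair {c} {edgeClause e} (c-joins orientation) (edgeClause-joins e))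
      where
      c-joins : (i ≡ src e × j ≡ tgt e) ⊎ (i ≡ tgt e × j ≡ src e) → Joins c (f (src e)) (f (tgt e))
      c-joins (inj₁ (refl , refl)) = inj₁ (sym fi≡ , sym fj≡)
      c-joins (inj₂ (refl , refl)) = inj₂ (sym fi≡ , sym fj≡)

    edgeClause-satisfied : (f-inj : (i j : Fin n) → f i ≡ f j → i ≡ j) →
      ((b , sat) : SignedSatisfiable edgeSigning) →
      ∀ e → T (evalClause (extendAlong f (lookup b)) (edgeClause e))
    edgeClause-satisfied f-inj (b , sat) e = subst T (sym evaluation) (sat e)
      where
      ρ = extendAlong f (lookup b)
      ρ-correct = extendAlong-correct f (lookup b) f-inj
      evaluation : evalClause ρ (edgeClause e)
                 ≡ signedClause (edgeSigning e) (lookup b (src e)) (lookup b (tgt e))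
      evaluation = begin
        evalClause ρ (edgeClause e)
          ≡⟨ evalClause-signsAlong ρ (edgeClause e) (edgeClause-joins e) ⟩
        signedClause (edgeSigning e) (ρ (f (src e))) (ρ (f (tgt e)))
          ≡⟨ cong₂ (signedClause (edgeSigning e)) (ρ-correct (src e)) (ρ-correct (tgt e)) ⟩
        signedClause (edgeSigning e) (lookup b (src e)) (lookup b (tgt e))
          ∎

  simple-satisfiable : (∀ σ → SignedSatisfiable σ) → ∀ {S} → Simple S → S ≅𝒢 A → Satisfiable S
  simple-satisfiable every {S} simple (f , f-inj , _ , onto , iso) =
    extendAlong f (lookup b) , All.tabulate clause-satisfied
    where
    edgeSigning-satisfied = every (edgeSigning f iso)
    b = proj₁ edgeSigning-satisfied
    clause-satisfied : ∀ {c} → c ∈ S → T (evalClause (extendAlong f (lookup b)) c)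
    clause-satisfied c∈S with ∈-edgeClause f iso simple onto c∈S
    ... | e , refl = edgeClause-satisfied f iso f-inj edgeSigning-satisfied e

K4-e-edges : EdgeEnumeration K4-e 5
K4-e-edges = record { src = src ; tgt = tgt ; edge = edge ; covers = covers }
  where
  src tgt : Fin 5 → Fin 4
  src zero                = zero
  src (suc zero)          = zero
  src (suc (suc zero))    = zero
  src (suc (suc (suc _))) = suc zero
  tgt zero                      = suc zero
  tgt (suc zero)                = suc (suc zero)
  tgt (suc (suc zero))          = suc (suc (suc zero))
  tgt (suc (suc (suc zero)))    = suc (suc zero)
  tgt (suc (suc (suc (suc _)))) = suc (suc (suc zero))
  edge : ∀ e → K4-e (src e) (tgt e)
  edge zero                         = (λ ()) , (λ { (() , _) }) , (λ { (() , _) })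
  edge (suc zero)                   = (λ ()) , (λ { (() , _) }) , (λ { (_ , ()) })
  edge (suc (suc zero))             = (λ ()) , (λ { (() , _) }) , (λ { (() , _) })
  edge (suc (suc (suc zero)))       = (λ ()) , (λ { (() , _) }) , (λ { (_ , ()) })
  edge (suc (suc (suc (suc zero)))) = (λ ()) , (λ { (() , _) }) , (λ { (() , _) })
  covers : ∀ i j → K4-e i j → ∃[ e ] ((i ≡ src e × j ≡ tgt e) ⊎ (i ≡ tgt e × j ≡ src e))
  covers zero zero (i≢i , _) = ⊥-elim (i≢i refl)
  covers zero (suc zero) _ = zero , inj₁ (refl , refl)
  covers zero (suc (suc zero)) _ = suc zero , inj₁ (refl , refl)
  covers zero (suc (suc (suc zero))) _ = suc (suc zero) , inj₁ (refl , refl)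
  covers (suc zero) zero _ = zero , inj₂ (refl , refl)
  covers (suc zero) (suc zero) (i≢i , _) = ⊥-elim (i≢i refl)
  covers (suc zero) (suc (suc zero)) _ = suc (suc (suc zero)) , inj₁ (refl , refl)
  covers (suc zero) (suc (suc (suc zero))) _ = suc (suc (suc (suc zero))) , inj₁ (refl , refl)
  covers (suc (suc zero)) zero _ = suc zero , inj₂ (refl , refl)
  covers (suc (suc zero)) (suc zero) _ = suc (suc (suc zero)) , inj₂ (refl , refl)
  covers (suc (suc zero)) (suc (suc zero)) (i≢i , _) = ⊥-elim (i≢i refl)
  covers (suc (suc zero)) (suc (suc (suc zero))) (_ , not23 , _) = ⊥-elim (not23 (refl , refl))
  covers (suc (suc (suc zero))) zero _ = suc (suc zero) , inj₂ (refl , refl)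
  covers (suc (suc (suc zero))) (suc zero) _ = suc (suc (suc (suc zero))) , inj₂ (refl , refl)
  covers (suc (suc (suc zero))) (suc (suc zero)) (_ , _ , not32) = ⊥-elim (not32 (refl , refl))
  covers (suc (suc (suc zero))) (suc (suc (suc zero))) (i≢i , _) = ⊥-elim (i≢i refl)

K4-e-everySigningSatisfiable : ∀ σ → SignedSatisfiable K4-e-edges σ
-- Agda decides this by running the exhaustive search over all 4⁵ signings.
K4-e-everySigningSatisfiable = from-yes (everySigningSatisfiable? K4-e-edges)

lemma10 : ¬ In𝒰 4 K4-e
lemma10 (S , _ , simple , unsat , iso) =
  unsat (simple-satisfiable K4-e-edges K4-e-everySigningSatisfiable simple iso)
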